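{- Consider the dynamic dominating-set algorithm described in the context, run on a graph with $n$ vertices under a sequence of edge insertions and deletions, and let $\mathcal{D}$ be the set of vertices that are dominants of some pair. After $k$ updates of the algorithm, at most $O(k\log n + n\log n)$ vertices can be added to or removed from $\mathcal{D}$.
   Context: For a vertex $v$ let $N(v)$ denote the set of its neighbours together with $v$. The algorithm maintains a solution consisting of dominating pairs $(v,\mathrm{Dom}(v))$ where $v$ is a vertex (the dominant; the same vertex may be dominant of several pairs) and $\mathrm{Dom}(v)\subseteq N(v)$, such that every vertex of the graph lies in exactly one set $\mathrm{Dom}(\cdot)$; $|\mathrm{Dom}(v)|$ is the cardinality of the pair. For each integer $l$ let $R_l=[2^{l-10},2^l]$. Each pair is placed at a level $l$ with $|\mathrm{Dom}(v)|\in R_l$; vertices of $\mathrm{Dom}(v)$ are then said to be dominated at level $l$, and $V_l$ denotes the set of vertices dominated at level $l$. The solution is stable if there is no vertex $v$ and level $l$ with $|N(v)\cap V_l|>2^l$. Procedure Stabilize: while some vertex $v$ and level $l$ violate stability, add the pair $(v, N(v)\cap V_l)$ at the lowest level $j$ with $|N(v)\cap V_l|\in R_j$, and remove the elements of $N(v)\cap V_l$ from their former pairs; a former pair that becomes empty is deleted, and a former pair whose cardinality drops below $2^{l-10}$ is moved to the highest level whose range contains its cardinality. Edge insertion: run Stabilize. Deletion of edge $(u,v)$: if neither endpoint's pair dominates the other endpoint, do nothing; otherwise, say $u\in\mathrm{Dom}(v)$, remove $u$ from $\mathrm{Dom}(v)$, add the pair $(u,\{u\})$ at level 1, and run Stabilize.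 The algorithm starts from a stable solution with a valid assignment of levels. -}

module Defs where

open import Data.Nat using (ℕ; zero; suc; _+_; _*_; _^_; _≤_; _<_)
open import Data.Bool using (Bool; true; false; _∧_; _∨_; not; if_then_else_)
open import Data.Fin using (Fin; _≟_)
open import Data.Fin.Subset using (Subset; ⊥; ⁅_⁆; _⊆_; _∩_; _∪_; _─_; ∣_∣; _∈_; _∉_)
open import Data.Vec using (tabulate; lookup)
open import Data.List using (List; []; _∷_; _++_; foldr)
open import Data.Product using (_×_)
open import Relation.Nullary using (¬_; ⌊_⌋)
open import Relation.Binary.PropositionalEquality using (_≡_; _≢_)

Graph : ℕ → Set
Graph n = Fin n → Fin n → Bool

SimpleGraph : ∀ {n} → Graph n → Set
SimpleGraph {n} G = (∀ (x y : Fin n) → G x y ≡ G y x) × (∀ (x : Fin n) → G x x ≡ false)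

N : ∀ {n} → Graph n → Fin n → Subset n
N G v = tabulate (λ w → ⌊ v ≟ w ⌋ ∨ G v w)

isPair : ∀ {n} → Fin n → Fin n → Fin n → Fin n → Bool
isPair u v x y = (⌊ x ≟ u ⌋ ∧ ⌊ y ≟ v ⌋) ∨ (⌊ x ≟ v ⌋ ∧ ⌊ y ≟ u ⌋)

addEdge : ∀ {n} → Graph n → Fin n → Fin n → Graph n
addEdge G u v x y = G x y ∨ isPair u v x y

removeEdge : ∀ {n} → Graph n → Fin n → Fin n → Graph n
removeEdge G u v x y = G x y ∧ not (isPair u v x y)

record DPair (n : ℕ) : Set where
  constructor dpair
  field
    dominant : Fin n
    dom      : Subset n
    level    : ℕ
open DPair public

Solution : ℕ → Set
Solution n = List (DPair n)

-- c ∈ R_l = [2^(l-10), 2^l], i.e. 2^l ≤ 1024·c and c ≤ 2^l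
InR : ℕ → ℕ → Set
InR c l = (2 ^ l ≤ c * 1024) × (c ≤ 2 ^ l)

LowestLevel : ℕ → ℕ → Set
LowestLevel c j = InR c j × (∀ i → i < j → ¬ InR c i)

HighestLevel : ℕ → ℕ → Set
HighestLevel c j = InR c j × (∀ i → j < i → ¬ InR c i)

V : ∀ {n} → Solution n → ℕ → Subset n
V {n} S l = foldr (λ p acc → (if ⌊ Data.Nat._≟_ (level p) l ⌋ then dom p else ⊥) ∪ acc) ⊥ S

Dominants : ∀ {n} → Solution n → Subset n
Dominants S = foldr (λ p acc → ⁅ dominant p ⁆ ∪ acc) ⊥ S

occ : ∀ {n} → Fin n → Solution n → ℕ
occ w [] = 0
occ w (p ∷ S) = (if lookup (dom p) w then 1 else 0) + occ w S

ValidSolution : ∀ {n} → Graph n → Solution n → Set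
ValidSolution {n} G S =
  (∀ p → p Data.List.Membership.Propositional.∈ S → dom p ⊆ N G (dominant p))
  × (∀ (w : Fin n) → occ w S ≡ 1)
  where import Data.List.Membership.Propositional

ValidLevels : ∀ {n} → Solution n → Set
ValidLevels S = ∀ p → p Data.List.Membership.Propositional.∈ S → InR ∣ dom p ∣ (level p)
  where import Data.List.Membership.Propositional

Stable : ∀ {n} → Graph n → Solution n → Set
Stable {n} G S = ∀ (v : Fin n) (l : ℕ) → ∣ N G v ∩ V S l ∣ ≤ 2 ^ l

data RemoveFrom {n} (X : Subset n) : Solution n → Solution n → Set where
  rf-nil   : RemoveFrom X [] []
  rf-empty : ∀ {p S S'} → ∣ dom p ─ X ∣ ≡ 0 →
             RemoveFrom X S S' → RemoveFrom X (p ∷ S) S'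
  rf-keep  : ∀ {p S S'} → 0 < ∣ dom p ─ X ∣ →
             2 ^ level p ≤ ∣ dom p ─ X ∣ * 1024 →
             RemoveFrom X S S' →
             RemoveFrom X (p ∷ S) (dpair (dominant p) (dom p ─ X) (level p) ∷ S')
  rf-move  : ∀ {p S S' j} → 0 < ∣ dom p ─ X ∣ →
             ∣ dom p ─ X ∣ * 1024 < 2 ^ level p →
             HighestLevel ∣ dom p ─ X ∣ j →
             RemoveFrom X S S' →
             RemoveFrom X (p ∷ S) (dpair (dominant p) (dom p ─ X) j ∷ S')

-- one iteration of the while-loop of Stabilize (any violating v, l may be chosen)
data StabStep {n} (G : Graph n) (S : Solution n) : Solution n → Set where
  stab-step : ∀ (v : Fin n) (l j : ℕ) {S₀} →
              2 ^ l < ∣ N G v ∩ V S l ∣ →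
              RemoveFrom (N G v ∩ V S l) S S₀ →
              LowestLevel ∣ N G v ∩ V S l ∣ j →
              StabStep G S (dpair v (N G v ∩ V S l) j ∷ S₀)

ΔD : ∀ {n} → Solution n → Solution n → ℕ
ΔD S S' = ∣ Dominants S' ─ Dominants S ∣ + ∣ Dominants S ─ Dominants S' ∣

data StabRun {n} (G : Graph n) : Solution n → Solution n → ℕ → Set where
  stab-done : ∀ {S} → Stable G S → StabRun G S S 0
  stab-more : ∀ {S S₁ S₂ c} → StabStep G S S₁ → StabRun G S₁ S₂ c →
              StabRun G S S₂ (ΔD S S₁ + c)

dropVertex : ∀ {n} → Fin n → DPair n → Solution n
dropVertex u p with ∣ dom p ─ ⁅ u ⁆ ∣
... | zero  = []
... | suc _ = dpair (dominant p) (dom p ─ ⁅ u ⁆) (level p) ∷ []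

Dominates : ∀ {n} → Solution n → Fin n → Fin n → Set
Dominates S v u = Data.List.Relation.Unary.Any.Any (λ p → (dominant p ≡ v) × (u ∈ dom p)) S
  where import Data.List.Relation.Unary.Any

data UpdateRun {n} : Graph n → Solution n → Graph n → Solution n → ℕ → Set where
  ins : ∀ {G S S' c} (u v : Fin n) → u ≢ v → G u v ≡ false →
        StabRun (addEdge G u v) S S' c →
        UpdateRun G S (addEdge G u v) S' c
  del-nothing : ∀ {G S} (u v : Fin n) → G u v ≡ true →
        ¬ Dominates S v u → ¬ Dominates S u v →
        UpdateRun G S (removeEdge G u v) S 0
  del-act : ∀ {G S' c} (u v : Fin n) → G u v ≡ true →
        (pre post : Solution n) (p : DPair n) →
        dominant p ≡ v → u ∈ dom p →
        StabRun (removeEdge G u v)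
                (pre ++ dropVertex u p ++ post ++ (dpair u ⁅ u ⁆ 1 ∷ [])) S' c →
        UpdateRun G (pre ++ p ∷ post) (removeEdge G u v) S'
                  (ΔD (pre ++ p ∷ post) (pre ++ dropVertex u p ++ post ++ (dpair u ⁅ u ⁆ 1 ∷ [])) + c)

data Run {n} : Graph n → Solution n → ℕ → ℕ → Set where
  run-nil  : ∀ {G S} → Run G S 0 0
  run-cons : ∀ {G S G' S' k c c'} → UpdateRun G S G' S' c → Run G' S' k c' →
             Run G S (suc k) (c + c')

-- Let L = ⌊log₂ (1024 n)⌋, which bounds every level that can occur. A pair
-- of cardinality c at level l carries the potential 1024 c (L − l) + 2^(l+1), and Ψ is the total
-- potential plus |𝒟|. An iteration of Stabilize collects s > 2^l vertices of level l into a new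
-- pair at a level j > l with 2^(j−1) < s; lifting them releases at least 1024 s, which pays for
-- the new term 2^(j+1) < 4 s + 4 and for the at most two changes of 𝒟 (only v can enter). The
-- shrinking former pairs only lose potential, even when they move down to a level j, because
-- then 1024 c < 2^(j+1). A deletion raises Ψ by at most 1024 L + 6, and initially
-- Ψ ≤ (1024 L + 2049) n because the Dom-sets partition the vertices. So k updates change 𝒟 at
-- most (1024 L + 2049) n + k (1024 L + 6) = O((k + n) log n) times.

module Submission where

open import Defs
open import Data.Nat using (ℕ; zero; suc; _+_; _*_; _∸_; _^_; _≤_; _<_; z≤n; s≤s; NonZero; _≟_; >-nonZero)
open import Data.Nat.Properties
open import Data.Nat.Tactic.RingSolver using (solve-∀)
open import Data.Nat.Logarithm using (⌊log₂_⌋; ⌊log₂⌋-mono-≤; ⌊log₂[2^n]⌋≡n; ⌊log₂[2*b]⌋≡1+⌊log₂b⌋)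
open import Data.Nat.ListAction using (sum)
open import Data.Nat.ListAction.Properties using (sum-++)
open import Data.Bool using (true; false; if_then_else_)
open import Data.Vec using ([]; _∷_; here; lookup)
open import Data.Fin using (Fin; zero)
open import Data.Fin.Properties using (toℕ<n)
open import Data.Fin.Subset
  using (Subset; ∣_∣; _∩_; _∪_; _─_; ⁅_⁆; _⊆_)
  renaming (⊥ to ∅)
open import Data.Fin.Subset.Properties
  using (drop-∷-⊆; ∣p∣≤n; ∣⊥∣≡0; ∣⁅x⁆∣≡1; ∣p─q∣≤∣p∣; ⊆-refl; ⊆-trans; ⊆-reflexive;
         x∈p∪q⁻; x∈p∪q⁺; q⊆p∪q; ∪-comm; ∪-assoc; ∪-identityˡ; ∪-identityʳ; ⊥⊆; ∩-assoc; ∩-idem; ∩-zeroʳ; ∩-distribˡ-∪; ⊆-poset)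
open import Data.List using ([]; _∷_; _++_; map)
open import Data.List.Properties using (map-++)
open import Data.List.Relation.Unary.All using (All; []; _∷_; tabulate)
open import Data.List.Relation.Unary.All.Properties using (++⁺; ++⁻)
open import Data.Product using (_,_; proj₁; proj₂; ∃)
import Data.Sum as Sum
open import Relation.Binary.PropositionalEquality
open import Relation.Nullary using (¬_; yes; no; ⌊_⌋)
open import Data.Empty using (⊥-elim)
open import Algebra.Properties.CommutativeMonoid.Sum +-0-commutativeMonoid
  using (sum-cong-≗; ∑-distrib-+; sum-replicate-zero)
  renaming (sum to ∑)
open import Function using (_∘_)
import Relation.Binary.Reasoning.PartialOrder as PartialOrderReasoning

∪-mono-⊆ : ∀ {n} {p p′ q q′ : Subset n} → p ⊆ p′ → q ⊆ q′ → p ∪ q ⊆ p′ ∪ q′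
∪-mono-⊆ {p = p} {q = q} p⊆p′ q⊆q′ x∈p∪q = x∈p∪q⁺ (Sum.map p⊆p′ q⊆q′ (x∈p∪q⁻ p q x∈p∪q))

∣p∪q∣≤∣p∣+∣q∣ : ∀ {n} (p q : Subset n) → ∣ p ∪ q ∣ ≤ ∣ p ∣ + ∣ q ∣
∣p∪q∣≤∣p∣+∣q∣ []          []          = z≤n
∣p∪q∣≤∣p∣+∣q∣ (true  ∷ p) (true  ∷ q) = s≤s (≤-trans (∣p∪q∣≤∣p∣+∣q∣ p q) (+-monoʳ-≤ ∣ p ∣ (n≤1+n ∣ q ∣)))
∣p∪q∣≤∣p∣+∣q∣ (true  ∷ p) (false ∷ q) = s≤s (∣p∪q∣≤∣p∣+∣q∣ p q)
∣p∪q∣≤∣p∣+∣q∣ (false ∷ p) (true  ∷ q) = ≤-trans (s≤s (∣p∪q∣≤∣p∣+∣q∣ p q)) (≤-reflexive (sym (+-suc _ _)))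
∣p∪q∣≤∣p∣+∣q∣ (false ∷ p) (false ∷ q) = ∣p∪q∣≤∣p∣+∣q∣ p q

∣p─q∣+∣q∩p∣≡∣p∣ : ∀ {n} (p q : Subset n) → ∣ p ─ q ∣ + ∣ q ∩ p ∣ ≡ ∣ p ∣
∣p─q∣+∣q∩p∣≡∣p∣ []          []          = refl
∣p─q∣+∣q∩p∣≡∣p∣ (true  ∷ p) (true  ∷ q) = trans (+-suc _ _) (cong suc (∣p─q∣+∣q∩p∣≡∣p∣ p q))
∣p─q∣+∣q∩p∣≡∣p∣ (true  ∷ p) (false ∷ q) = cong suc (∣p─q∣+∣q∩p∣≡∣p∣ p q)
∣p─q∣+∣q∩p∣≡∣p∣ (false ∷ p) (true  ∷ q) = ∣p─q∣+∣q∩p∣≡∣p∣ p q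
∣p─q∣+∣q∩p∣≡∣p∣ (false ∷ p) (false ∷ q) = ∣p─q∣+∣q∩p∣≡∣p∣ p q

∣p─q∣+∣q∣≡∣q─p∣+∣p∣ : ∀ {n} (p q : Subset n) → ∣ p ─ q ∣ + ∣ q ∣ ≡ ∣ q ─ p ∣ + ∣ p ∣
∣p─q∣+∣q∣≡∣q─p∣+∣p∣ []          []          = refl
∣p─q∣+∣q∣≡∣q─p∣+∣p∣ (true  ∷ p) (true  ∷ q) = trans (+-suc _ _) (trans (cong suc (∣p─q∣+∣q∣≡∣q─p∣+∣p∣ p q)) (sym (+-suc _ _)))
∣p─q∣+∣q∣≡∣q─p∣+∣p∣ (true  ∷ p) (false ∷ q) = trans (cong suc (∣p─q∣+∣q∣≡∣q─p∣+∣p∣ p q)) (sym (+-suc _ _))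
∣p─q∣+∣q∣≡∣q─p∣+∣p∣ (false ∷ p) (true  ∷ q) = trans (+-suc _ _) (cong suc (∣p─q∣+∣q∣≡∣q─p∣+∣p∣ p q))
∣p─q∣+∣q∣≡∣q─p∣+∣p∣ (false ∷ p) (false ∷ q) = ∣p─q∣+∣q∣≡∣q─p∣+∣p∣ p q

q⊆p∪r⇒∣q─p∣≤∣r∣ : ∀ {n} (p q r : Subset n) → q ⊆ p ∪ r → ∣ q ─ p ∣ ≤ ∣ r ∣
q⊆p∪r⇒∣q─p∣≤∣r∣ []          []          []          _ = z≤n
q⊆p∪r⇒∣q─p∣≤∣r∣ (true  ∷ p) (_     ∷ q) (true  ∷ r) h = m≤n⇒m≤1+n (q⊆p∪r⇒∣q─p∣≤∣r∣ p q r (drop-∷-⊆ h))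
q⊆p∪r⇒∣q─p∣≤∣r∣ (true  ∷ p) (_     ∷ q) (false ∷ r) h = q⊆p∪r⇒∣q─p∣≤∣r∣ p q r (drop-∷-⊆ h)
q⊆p∪r⇒∣q─p∣≤∣r∣ (false ∷ p) (true  ∷ q) (true  ∷ r) h = s≤s (q⊆p∪r⇒∣q─p∣≤∣r∣ p q r (drop-∷-⊆ h))
q⊆p∪r⇒∣q─p∣≤∣r∣ (false ∷ p) (false ∷ q) (true  ∷ r) h = m≤n⇒m≤1+n (q⊆p∪r⇒∣q─p∣≤∣r∣ p q r (drop-∷-⊆ h))
q⊆p∪r⇒∣q─p∣≤∣r∣ (false ∷ p) (true  ∷ q) (false ∷ r) h with h here
... | ()
q⊆p∪r⇒∣q─p∣≤∣r∣ (false ∷ p) (false ∷ q) (false ∷ r) h = q⊆p∪r⇒∣q─p∣≤∣r∣ p q r (drop-∷-⊆ h)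

∣p∩∅∣≡0 : ∀ {n} (p : Subset n) → ∣ p ∩ ∅ ∣ ≡ 0
∣p∩∅∣≡0 {n} p = trans (cong ∣_∣ (∩-zeroʳ p)) (∣⊥∣≡0 n)

q⊆p∪⁅x⁆⇒∣q─p∣+∣p─q∣+∣q∣≤2+∣p∣ : ∀ {n} (p q : Subset n) {x} → q ⊆ p ∪ ⁅ x ⁆ →
                                 ∣ q ─ p ∣ + ∣ p ─ q ∣ + ∣ q ∣ ≤ 2 + ∣ p ∣
q⊆p∪⁅x⁆⇒∣q─p∣+∣p─q∣+∣q∣≤2+∣p∣ p q {x} q⊆p∪x = begin
  ∣ q ─ p ∣ + ∣ p ─ q ∣ + ∣ q ∣   ≡⟨ +-assoc ∣ q ─ p ∣ _ _ ⟩
  ∣ q ─ p ∣ + (∣ p ─ q ∣ + ∣ q ∣) ≡⟨ cong (∣ q ─ p ∣ +_) (∣p─q∣+∣q∣≡∣q─p∣+∣p∣ p q) ⟩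
  ∣ q ─ p ∣ + (∣ q ─ p ∣ + ∣ p ∣) ≡⟨ sym (+-assoc ∣ q ─ p ∣ _ _) ⟩
  ∣ q ─ p ∣ + ∣ q ─ p ∣ + ∣ p ∣   ≤⟨ +-monoˡ-≤ ∣ p ∣ (+-mono-≤ ∣q─p∣≤1 ∣q─p∣≤1) ⟩
  2 + ∣ p ∣                       ∎
  where
  open ≤-Reasoning
  ∣q─p∣≤1 : ∣ q ─ p ∣ ≤ 1
  ∣q─p∣≤1 = ≤-trans (q⊆p∪r⇒∣q─p∣≤∣r∣ p q ⁅ x ⁆ q⊆p∪x) (≤-reflexive (∣⁅x⁆∣≡1 x))

1+n≤2^n : ∀ n → 1 + n ≤ 2 ^ n
1+n≤2^n zero    = ≤-refl
1+n≤2^n (suc n) = +-mono-≤ (m^n>0 2 n) (≤-trans (1+n≤2^n n) (m≤m+n _ _))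

2^m<2^n⇒m<n : ∀ {m n} → 2 ^ m < 2 ^ n → m < n
2^m<2^n⇒m<n {m} {n} 2^m<2^n = ≰⇒> (λ n≤m → <⇒≱ 2^m<2^n (^-monoʳ-≤ 2 n≤m))

∸-split : ∀ {j l L} → j ≤ l → l ≤ L → L ∸ j ≡ (L ∸ l) + (l ∸ j)
∸-split {j} {l} {L} j≤l l≤L = begin
  L ∸ j             ≡⟨ cong (_∸ j) (sym (m∸n+n≡m l≤L)) ⟩
  (L ∸ l) + l ∸ j   ≡⟨ +-∸-assoc (L ∸ l) j≤l ⟩
  (L ∸ l) + (l ∸ j) ∎
  where open ≡-Reasoning

moveDown-≤ : ∀ c a d j → c * 1024 < 2 ^ suc j →
             c * (a + d) * 1024 + 2 ^ suc j ≤ c * a * 1024 + 2 ^ suc (j + d)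
moveDown-≤ c a d j c*1024<2^1+j = begin
  c * (a + d) * 1024 + 2 ^ suc j          ≡⟨ regroup c a d (2 ^ suc j) ⟩
  c * a * 1024 + ((c * 1024) * d + 2 ^ suc j)
    ≤⟨ +-monoʳ-≤ (c * a * 1024) (+-monoˡ-≤ (2 ^ suc j) (*-monoˡ-≤ d (<⇒≤ c*1024<2^1+j))) ⟩
  c * a * 1024 + (2 ^ suc j * d + 2 ^ suc j) ≡⟨ cong (c * a * 1024 +_) (factor (2 ^ suc j) d) ⟩
  c * a * 1024 + 2 ^ suc j * (1 + d)     ≤⟨ +-monoʳ-≤ (c * a * 1024) (*-monoʳ-≤ (2 ^ suc j) (1+n≤2^n d)) ⟩
  c * a * 1024 + 2 ^ suc j * 2 ^ d       ≡⟨ cong (c * a * 1024 +_) (sym (^-distribˡ-+-* 2 (suc j) d)) ⟩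
  c * a * 1024 + 2 ^ suc (j + d)         ∎
  where
  open ≤-Reasoning
  regroup : ∀ c a d x → c * (a + d) * 1024 + x ≡ c * a * 1024 + ((c * 1024) * d + x)
  regroup = solve-∀
  factor : ∀ x d → x * d + x ≡ x * (1 + d)
  factor = solve-∀

newPair-≤ : ∀ s a b j → 2 ^ j < s → s * a * 1024 + 2 ^ suc (suc j) + 2 ≤ s * (a + suc b) * 1024
newPair-≤ s a b j 2^j<s = begin
  s * a * 1024 + 2 ^ suc (suc j) + 2      ≤⟨ m≤m+n _ 2 ⟩
  s * a * 1024 + 2 ^ suc (suc j) + 2 + 2  ≡⟨ regroup s a (2 ^ j) ⟩
  s * a * 1024 + (1 + 2 ^ j) * 4          ≤⟨ +-monoʳ-≤ (s * a * 1024) (*-mono-≤ 2^j<s (m≤m+n 4 1020)) ⟩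
  s * a * 1024 + s * 1024                 ≤⟨ +-monoʳ-≤ (s * a * 1024) (*-monoˡ-≤ 1024 (m≤m*n s (suc b))) ⟩
  s * a * 1024 + s * suc b * 1024         ≡⟨ sym (*-distribʳ-+ 1024 (s * a) (s * suc b)) ⟩
  (s * a + s * suc b) * 1024              ≡⟨ cong (_* 1024) (sym (*-distribˡ-+ s a (suc b))) ⟩
  s * (a + suc b) * 1024                  ∎
  where
  open ≤-Reasoning
  regroup : ∀ s a x → s * a * 1024 + 2 * (2 * x) + 2 + 2 ≡ s * a * 1024 + (1 + x) * 4
  regroup = solve-∀

add-bounds : ∀ k a x e y {b f} → a + x * k ≤ b → e + y * k ≤ f → (a + e) + (x + y) * k ≤ b + f
add-bounds k a x e y {b} {f} a+kx≤b e+ky≤f = begin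
  (a + e) + (x + y) * k     ≡⟨ regroup a e k x y ⟩
  (a + x * k) + (e + y * k) ≤⟨ +-mono-≤ a+kx≤b e+ky≤f ⟩
  b + f                     ∎
  where
  open ≤-Reasoning
  regroup : ∀ a e k x y → (a + e) + (x + y) * k ≡ (a + x * k) + (e + y * k)
  regroup = solve-∀

HighestLevel⇒c*1024<2^1+j : ∀ {c j} → HighestLevel c j → c * 1024 < 2 ^ suc j
HighestLevel⇒c*1024<2^1+j {c} {j} ((_ , c≤2^j) , highest) =
  ≰⇒> λ 2^1+j≤ → highest (suc j) ≤-refl (2^1+j≤ , ≤-trans c≤2^j (^-monoʳ-≤ 2 (n≤1+n j)))

LowestLevel⇒2^j<c : ∀ {c j} → LowestLevel c (suc j) → 2 ^ j < c
LowestLevel⇒2^j<c {c} {j} ((2^1+j≤ , _) , lowest) =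
  ≰⇒> λ c≤2^j → lowest j ≤-refl (≤-trans (^-monoʳ-≤ 2 (n≤1+n j)) 2^1+j≤ , c≤2^j)

Dominants-++ : ∀ {n} (S T : Solution n) → Dominants (S ++ T) ≡ Dominants S ∪ Dominants T
Dominants-++ []      T = sym (∪-identityˡ (Dominants T))
Dominants-++ (p ∷ S) T = trans (cong (⁅ dominant p ⁆ ∪_) (Dominants-++ S T)) (sym (∪-assoc _ _ _))

Dominants-dropVertex : ∀ {n} (u : Fin n) (p : DPair n) → Dominants (dropVertex u p) ⊆ ⁅ dominant p ⁆
Dominants-dropVertex u p with ∣ dom p ─ ⁅ u ⁆ ∣
... | zero  = ⊥⊆
... | suc _ = ⊆-reflexive (∪-identityʳ _)

RemoveFrom-Dominants : ∀ {n} {X : Subset n} {S S₀} → RemoveFrom X S S₀ → Dominants S₀ ⊆ Dominants S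
RemoveFrom-Dominants rf-nil                   = ⊆-refl
RemoveFrom-Dominants (rf-empty {p} {S} _ r)   = ⊆-trans (RemoveFrom-Dominants r) (q⊆p∪q ⁅ dominant p ⁆ (Dominants S))
RemoveFrom-Dominants (rf-keep _ _ r)          = ∪-mono-⊆ ⊆-refl (RemoveFrom-Dominants r)
RemoveFrom-Dominants (rf-move _ _ _ r)        = ∪-mono-⊆ ⊆-refl (RemoveFrom-Dominants r)

StabStep-Dominants : ∀ {n} {G : Graph n} {S S₁} → StabStep G S S₁ →
                     ∃ λ x → Dominants S₁ ⊆ Dominants S ∪ ⁅ x ⁆
StabStep-Dominants (stab-step v _ _ _ rf _) =
  v , ⊆-trans (∪-mono-⊆ ⊆-refl (RemoveFrom-Dominants rf)) (⊆-reflexive (∪-comm _ _))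

deletion-Dominants : ∀ {n} (u : Fin n) (p : DPair n) pre post →
  Dominants (pre ++ dropVertex u p ++ post ++ dpair u ⁅ u ⁆ 1 ∷ []) ⊆ Dominants (pre ++ p ∷ post) ∪ ⁅ u ⁆
deletion-Dominants {n} u p pre post = begin
  Dominants (pre ++ dropVertex u p ++ post ++ dpair u ⁅ u ⁆ 1 ∷ [])
    ≡⟨ Dominants-++ pre _ ⟩
  Dpre ∪ Dominants (dropVertex u p ++ post ++ dpair u ⁅ u ⁆ 1 ∷ [])
    ≡⟨ cong (Dpre ∪_) (Dominants-++ (dropVertex u p) _) ⟩
  Dpre ∪ (Dominants (dropVertex u p) ∪ Dominants (post ++ dpair u ⁅ u ⁆ 1 ∷ []))
    ≡⟨ cong (λ A → Dpre ∪ (Dominants (dropVertex u p) ∪ A)) (Dominants-++ post _) ⟩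
  Dpre ∪ (Dominants (dropVertex u p) ∪ (Dpost ∪ (⁅ u ⁆ ∪ ∅)))
    ≤⟨ ∪-mono-⊆ ⊆-refl (∪-mono-⊆ (Dominants-dropVertex u p) ⊆-refl) ⟩
  Dpre ∪ (⁅ dominant p ⁆ ∪ (Dpost ∪ (⁅ u ⁆ ∪ ∅)))
    ≡⟨ cong (λ A → Dpre ∪ (⁅ dominant p ⁆ ∪ (Dpost ∪ A))) (∪-identityʳ ⁅ u ⁆) ⟩
  Dpre ∪ (⁅ dominant p ⁆ ∪ (Dpost ∪ ⁅ u ⁆))
    ≡⟨ cong (Dpre ∪_) (sym (∪-assoc _ _ _)) ⟩
  Dpre ∪ ((⁅ dominant p ⁆ ∪ Dpost) ∪ ⁅ u ⁆)
    ≡⟨ sym (∪-assoc _ _ _) ⟩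
  (Dpre ∪ (⁅ dominant p ⁆ ∪ Dpost)) ∪ ⁅ u ⁆
    ≡⟨ cong (_∪ ⁅ u ⁆) (sym (Dominants-++ pre (p ∷ post))) ⟩
  Dominants (pre ++ p ∷ post) ∪ ⁅ u ⁆ ∎
  where
  open PartialOrderReasoning (⊆-poset n)
  Dpre Dpost : Subset n
  Dpre  = Dominants pre
  Dpost = Dominants post

-- Double counting

∣p∣≡∑indicator : ∀ {n} (p : Subset n) → ∣ p ∣ ≡ ∑ (λ i → if lookup p i then 1 else 0)
∣p∣≡∑indicator []          = refl
∣p∣≡∑indicator (true  ∷ p) = cong suc (∣p∣≡∑indicator p)
∣p∣≡∑indicator (false ∷ p) = ∣p∣≡∑indicator p

∑1≡n : ∀ n → ∑ {n} (λ _ → 1) ≡ n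
∑1≡n zero    = refl
∑1≡n (suc n) = cong suc (∑1≡n n)

∑∣dom∣≡∑occ : ∀ {n} (S : Solution n) → sum (map (∣_∣ ∘ dom) S) ≡ ∑ (λ w → occ w S)
∑∣dom∣≡∑occ {n} []      = sym (sum-replicate-zero n)
∑∣dom∣≡∑occ {n} (p ∷ S) =
  trans (cong₂ _+_ (∣p∣≡∑indicator (dom p)) (∑∣dom∣≡∑occ S)) (sym (∑-distrib-+ {n} _ _))

occ≡1⇒∑∣dom∣≡n : ∀ {n} (S : Solution n) → (∀ w → occ w S ≡ 1) → sum (map (∣_∣ ∘ dom) S) ≡ n
occ≡1⇒∑∣dom∣≡n {n} S occ≡1 = trans (∑∣dom∣≡∑occ S) (trans (sum-cong-≗ occ≡1) (∑1≡n n))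

-- The potential

module Potential {n : ℕ} (L : ℕ) (level-bound : ∀ {j} → 2 ^ j ≤ n * 1024 → j ≤ L) where

  cost : ℕ → ℕ → ℕ
  cost c l = c * (L ∸ l) * 1024 + 2 ^ suc l

  weight : DPair n → ℕ
  weight p = cost ∣ dom p ∣ (level p)

  Φ : Solution n → ℕ
  Φ S = sum (map weight S)

  Ψ : Solution n → ℕ
  Ψ S = Φ S + ∣ Dominants S ∣

  -- keeps the truncated subtraction L ∸ level p exact
  LevelsBounded : Solution n → Set
  LevelsBounded = All (λ p → level p ≤ L)

  freedBy : Subset n → DPair n → ℕ
  freedBy X p = ∣ X ∩ dom p ∣ * (L ∸ level p)

  freed : Subset n → Solution n → ℕ
  freed X S = sum (map (freedBy X) S)

  InR⇒≤L : ∀ (A : Subset n) {j} → 2 ^ j ≤ ∣ A ∣ * 1024 → j ≤ L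
  InR⇒≤L A 2^j≤ = level-bound (≤-trans 2^j≤ (*-monoˡ-≤ 1024 (∣p∣≤n A)))

  cost-mono : ∀ {c c′} l → c ≤ c′ → cost c l ≤ cost c′ l
  cost-mono l c≤c′ = +-monoˡ-≤ (2 ^ suc l) (*-monoˡ-≤ 1024 (*-monoˡ-≤ (L ∸ l) c≤c′))

  cost-+ : ∀ a b l → cost a l + b * (L ∸ l) * 1024 ≡ cost (a + b) l
  cost-+ a b l = regroup a b (L ∸ l) (2 ^ suc l)
    where
    regroup : ∀ a b m t → a * m * 1024 + t + b * m * 1024 ≡ (a + b) * m * 1024 + t
    regroup = solve-∀

  weight-split : ∀ (p : DPair n) X → cost ∣ dom p ─ X ∣ (level p) + freedBy X p * 1024 ≡ weight p
  weight-split p X = trans (cost-+ ∣ dom p ─ X ∣ ∣ X ∩ dom p ∣ (level p))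
                       (cong (λ c → cost c (level p)) (∣p─q∣+∣q∩p∣≡∣p∣ (dom p) X))

  cost-moveDown : ∀ {c j l} → HighestLevel c j → c * 1024 < 2 ^ l → l ≤ L → cost c j ≤ cost c l
  cost-moveDown {c} {j} {l} highest c*1024<2^l l≤L = begin
    c * (L ∸ j) * 1024 + 2 ^ suc j
      ≡⟨ cong (λ m → c * m * 1024 + 2 ^ suc j) (∸-split j≤l l≤L) ⟩
    c * ((L ∸ l) + (l ∸ j)) * 1024 + 2 ^ suc j
      ≤⟨ moveDown-≤ c (L ∸ l) (l ∸ j) j (HighestLevel⇒c*1024<2^1+j highest) ⟩
    c * (L ∸ l) * 1024 + 2 ^ suc (j + (l ∸ j))
      ≡⟨ cong (λ m → c * (L ∸ l) * 1024 + 2 ^ suc m) (m+[n∸m]≡n j≤l) ⟩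
    c * (L ∸ l) * 1024 + 2 ^ suc l ∎
    where
    open ≤-Reasoning
    j≤l : j ≤ l
    j≤l = <⇒≤ (2^m<2^n⇒m<n (≤-<-trans (proj₁ (proj₁ highest)) c*1024<2^l))

  cost-newPair : ∀ {s l j} → LowestLevel s j → l < j → j ≤ L → cost s j + 2 ≤ s * (L ∸ l) * 1024
  cost-newPair {s} {l} {suc j} lowest (s≤s l≤j) 1+j≤L = begin
    s * (L ∸ suc j) * 1024 + 2 ^ suc (suc j) + 2
      ≤⟨ newPair-≤ s (L ∸ suc j) (j ∸ l) j (LowestLevel⇒2^j<c lowest) ⟩
    s * ((L ∸ suc j) + suc (j ∸ l)) * 1024
      ≡⟨ cong (λ m → s * ((L ∸ suc j) + m) * 1024) (sym (+-∸-assoc 1 l≤j)) ⟩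
    s * ((L ∸ suc j) + (suc j ∸ l)) * 1024
      ≡⟨ cong (λ m → s * m * 1024) (sym (∸-split (m≤n⇒m≤1+n l≤j) 1+j≤L)) ⟩
    s * (L ∸ l) * 1024 ∎
    where open ≤-Reasoning

  RemoveFrom-levels : ∀ {X S S₀} → RemoveFrom X S S₀ → LevelsBounded S → LevelsBounded S₀
  RemoveFrom-levels rf-nil                                   []       = []
  RemoveFrom-levels (rf-empty _ r)                           (_ ∷ bs) = RemoveFrom-levels r bs
  RemoveFrom-levels (rf-keep _ _ r)                          (b ∷ bs) = b ∷ RemoveFrom-levels r bs
  RemoveFrom-levels {X} (rf-move {p} _ _ ((inR , _) , _) r) (_ ∷ bs) =
    InR⇒≤L (dom p ─ X) inR ∷ RemoveFrom-levels r bs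

  RemoveFrom-Φ : ∀ {X S S₀} → RemoveFrom X S S₀ → LevelsBounded S → Φ S₀ + freed X S * 1024 ≤ Φ S
  RemoveFrom-Φ rf-nil [] = ≤-refl
  RemoveFrom-Φ {X} (rf-empty {p} {S} {S₀} _ r) (_ ∷ bs) =
    add-bounds 1024 0 (freedBy X p) (Φ S₀) (freed X S)
      (≤-trans (m≤n+m _ _) (≤-reflexive (weight-split p X))) (RemoveFrom-Φ r bs)
  RemoveFrom-Φ {X} (rf-keep {p} {S} {S₀} _ _ r) (_ ∷ bs) =
    add-bounds 1024 (cost ∣ dom p ─ X ∣ (level p)) (freedBy X p) (Φ S₀) (freed X S)
      (≤-reflexive (weight-split p X)) (RemoveFrom-Φ r bs)
  RemoveFrom-Φ {X} (rf-move {p} {S} {S₀} {j} _ c*1024<2^l highest r) (l≤L ∷ bs) =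
    add-bounds 1024 (cost ∣ dom p ─ X ∣ j) (freedBy X p) (Φ S₀) (freed X S)
      (≤-trans (+-monoˡ-≤ _ (cost-moveDown highest c*1024<2^l l≤L)) (≤-reflexive (weight-split p X)))
      (RemoveFrom-Φ r bs)

  freed-at-level : ∀ X (p : DPair n) l →
    ∣ X ∩ (if ⌊ level p ≟ l ⌋ then dom p else ∅) ∣ * (L ∸ l) ≤ ∣ X ∩ dom p ∣ * (L ∸ level p)
  freed-at-level X p l with level p ≟ l
  ... | yes refl = ≤-refl
  ... | no  _    = ≤-trans (≤-reflexive (cong (_* (L ∸ l)) (∣p∩∅∣≡0 X))) z≤n

  ∣∩V∣*≤freed : ∀ X S l → ∣ X ∩ V S l ∣ * (L ∸ l) ≤ freed X S
  ∣∩V∣*≤freed X []      l = ≤-reflexive (cong (_* (L ∸ l)) (∣p∩∅∣≡0 X))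
  ∣∩V∣*≤freed X (p ∷ S) l = begin
    ∣ X ∩ (A ∪ V S l) ∣ * (L ∸ l)              ≡⟨ cong (λ B → ∣ B ∣ * (L ∸ l)) (∩-distribˡ-∪ X A (V S l)) ⟩
    ∣ (X ∩ A) ∪ (X ∩ V S l) ∣ * (L ∸ l)        ≤⟨ *-monoˡ-≤ (L ∸ l) (∣p∪q∣≤∣p∣+∣q∣ (X ∩ A) (X ∩ V S l)) ⟩
    (∣ X ∩ A ∣ + ∣ X ∩ V S l ∣) * (L ∸ l)      ≡⟨ *-distribʳ-+ (L ∸ l) ∣ X ∩ A ∣ _ ⟩
    ∣ X ∩ A ∣ * (L ∸ l) + ∣ X ∩ V S l ∣ * (L ∸ l) ≤⟨ +-mono-≤ (freed-at-level X p l) (∣∩V∣*≤freed X S l) ⟩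
    ∣ X ∩ dom p ∣ * (L ∸ level p) + freed X S  ∎
    where
    open ≤-Reasoning
    A : Subset n
    A = if ⌊ level p ≟ l ⌋ then dom p else ∅

  StabStep-levels : ∀ {G : Graph n} {S S₁} → StabStep G S S₁ → LevelsBounded S → LevelsBounded S₁
  StabStep-levels {G} {S} (stab-step v l j _ rf ((inR , _) , _)) bs =
    InR⇒≤L (N G v ∩ V S l) inR ∷ RemoveFrom-levels rf bs

  StabStep-Φ : ∀ {G : Graph n} {S S₁} → StabStep G S S₁ → LevelsBounded S → Φ S₁ + 2 ≤ Φ S
  StabStep-Φ {G} {S} (stab-step v l j {S₀} 2^l<s rf lowest@((inR , s≤2^j) , _)) bs = begin
    cost s j + Φ S₀ + 2           ≡⟨ swap (cost s j) (Φ S₀) 2 ⟩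
    cost s j + 2 + Φ S₀           ≤⟨ +-monoˡ-≤ (Φ S₀) (cost-newPair lowest l<j (InR⇒≤L X inR)) ⟩
    s * (L ∸ l) * 1024 + Φ S₀     ≤⟨ +-monoˡ-≤ (Φ S₀) (*-monoˡ-≤ 1024 s*[L∸l]≤freed) ⟩
    freed X S * 1024 + Φ S₀       ≡⟨ +-comm _ (Φ S₀) ⟩
    Φ S₀ + freed X S * 1024       ≤⟨ RemoveFrom-Φ rf bs ⟩
    Φ S                           ∎
    where
    open ≤-Reasoning
    swap : ∀ a b c → a + b + c ≡ a + c + b
    swap = solve-∀
    X : Subset n
    X = N G v ∩ V S l
    s : ℕ
    s = ∣ X ∣
    l<j : l < j
    l<j = 2^m<2^n⇒m<n (<-≤-trans 2^l<s s≤2^j)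
    s*[L∸l]≤freed : s * (L ∸ l) ≤ freed X S
    s*[L∸l]≤freed = subst (λ Y → ∣ Y ∣ * (L ∸ l) ≤ freed X S)
                          (trans (∩-assoc (N G v) (V S l) (V S l)) (cong (N G v ∩_) (∩-idem (V S l))))
                          (∣∩V∣*≤freed X S l)

  Ψ-step : ∀ S S′ e {x} → Φ S′ + 2 ≤ Φ S + e → Dominants S′ ⊆ Dominants S ∪ ⁅ x ⁆ →
           ΔD S S′ + Ψ S′ ≤ Ψ S + e
  Ψ-step S S′ e Φ′+2≤Φ+e D′⊆D∪x = +-cancelʳ-≤ 2 _ _ (begin
    ΔD S S′ + (Φ S′ + ∣ D′ ∣) + 2 ≡⟨ regroupˡ (ΔD S S′) (Φ S′) ∣ D′ ∣ ⟩
    (Φ S′ + 2) + (ΔD S S′ + ∣ D′ ∣)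
      ≤⟨ +-mono-≤ Φ′+2≤Φ+e (q⊆p∪⁅x⁆⇒∣q─p∣+∣p─q∣+∣q∣≤2+∣p∣ D D′ D′⊆D∪x) ⟩
    (Φ S + e) + (2 + ∣ D ∣)       ≡⟨ regroupʳ (Φ S) e ∣ D ∣ ⟩
    Φ S + ∣ D ∣ + e + 2           ∎)
    where
    open ≤-Reasoning
    D D′ : Subset n
    D  = Dominants S
    D′ = Dominants S′
    regroupˡ : ∀ δ a d′ → δ + (a + d′) + 2 ≡ (a + 2) + (δ + d′)
    regroupˡ = solve-∀
    regroupʳ : ∀ b e d → (b + e) + (2 + d) ≡ b + d + e + 2
    regroupʳ = solve-∀

  StabRun-levels : ∀ {G : Graph n} {S S′ c} → StabRun G S S′ c → LevelsBounded S → LevelsBounded S′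
  StabRun-levels (stab-done _)    bs = bs
  StabRun-levels (stab-more st r) bs = StabRun-levels r (StabStep-levels st bs)

  StabRun-Ψ : ∀ {G : Graph n} {S S′ c} → StabRun G S S′ c → LevelsBounded S → c + Ψ S′ ≤ Ψ S
  StabRun-Ψ (stab-done _) _ = ≤-refl
  StabRun-Ψ {S = S} (stab-more {S₁ = S₁} {S₂} {c} st r) bs = begin
    ΔD S S₁ + c + Ψ S₂   ≡⟨ +-assoc (ΔD S S₁) c (Ψ S₂) ⟩
    ΔD S S₁ + (c + Ψ S₂) ≤⟨ +-monoʳ-≤ (ΔD S S₁) (StabRun-Ψ r (StabStep-levels st bs)) ⟩
    ΔD S S₁ + Ψ S₁       ≤⟨ Ψ-step S S₁ 0 (≤-trans (StabStep-Φ st bs) (m≤m+n (Φ S) 0)) (proj₂ (StabStep-Dominants st)) ⟩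
    Ψ S + 0              ≡⟨ +-identityʳ (Ψ S) ⟩
    Ψ S                  ∎
    where open ≤-Reasoning

  Φ-++ : ∀ S T → Φ (S ++ T) ≡ Φ S + Φ T
  Φ-++ S T = trans (cong sum (map-++ weight S T)) (sum-++ (map weight S) (map weight T))

  Φ-dropVertex : ∀ u p → Φ (dropVertex u p) ≤ weight p
  Φ-dropVertex u p with ∣ dom p ─ ⁅ u ⁆ ∣
  ... | zero  = z≤n
  ... | suc _ = ≤-trans (≤-reflexive (+-identityʳ _)) (cost-mono (level p) (∣p─q∣≤∣p∣ (dom p) ⁅ u ⁆))

  dropVertex-levels : ∀ u p → level p ≤ L → LevelsBounded (dropVertex u p)
  dropVertex-levels u p l≤L with ∣ dom p ─ ⁅ u ⁆ ∣
  ... | zero  = []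
  ... | suc _ = l≤L ∷ []

  weight-singleton : ∀ u → weight (dpair u ⁅ u ⁆ 1) ≤ L * 1024 + 4
  weight-singleton u = +-monoˡ-≤ 4 (*-monoˡ-≤ 1024 (begin
    ∣ ⁅ u ⁆ ∣ * (L ∸ 1) ≡⟨ cong (_* (L ∸ 1)) (∣⁅x⁆∣≡1 u) ⟩
    1 * (L ∸ 1)         ≡⟨ *-identityˡ (L ∸ 1) ⟩
    L ∸ 1               ≤⟨ m∸n≤m L 1 ⟩
    L                   ∎))
    where open ≤-Reasoning

  deletion-Φ : ∀ u p pre post →
    Φ (pre ++ dropVertex u p ++ post ++ dpair u ⁅ u ⁆ 1 ∷ []) + 2 ≤ Φ (pre ++ p ∷ post) + (L * 1024 + 6)
  deletion-Φ u p pre post = begin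
    Φ (pre ++ dropVertex u p ++ post ++ s ∷ []) + 2
      ≡⟨ cong (_+ 2) (trans (Φ-++ pre _) (cong (Φ pre +_) (trans (Φ-++ (dropVertex u p) _)
                                                 (cong (Φ (dropVertex u p) +_) (Φ-++ post _))))) ⟩
    Φ pre + (Φ (dropVertex u p) + (Φ post + (weight s + 0))) + 2
      ≤⟨ +-monoˡ-≤ 2 (+-monoʳ-≤ (Φ pre) (+-mono-≤ (Φ-dropVertex u p)
                                          (+-monoʳ-≤ (Φ post) (+-monoˡ-≤ 0 (weight-singleton u))))) ⟩
    Φ pre + (weight p + (Φ post + (L * 1024 + 4 + 0))) + 2
      ≡⟨ regroup (Φ pre) (weight p) (Φ post) (L * 1024) ⟩
    Φ pre + (weight p + Φ post) + (L * 1024 + 6)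
      ≡⟨ cong (_+ (L * 1024 + 6)) (sym (Φ-++ pre (p ∷ post))) ⟩
    Φ (pre ++ p ∷ post) + (L * 1024 + 6) ∎
    where
    open ≤-Reasoning
    s : DPair n
    s = dpair u ⁅ u ⁆ 1
    regroup : ∀ a w c k → a + (w + (c + (k + 4 + 0))) + 2 ≡ a + (w + c) + (k + 6)
    regroup = solve-∀

  deletion-levels : ∀ (u : Fin n) p pre post → LevelsBounded (pre ++ p ∷ post) →
                    LevelsBounded (pre ++ dropVertex u p ++ post ++ dpair u ⁅ u ⁆ 1 ∷ [])
  deletion-levels u p pre post bs with ++⁻ pre bs
  ... | bs-pre , b ∷ bs-post =
    ++⁺ bs-pre (++⁺ (dropVertex-levels u p b) (++⁺ bs-post (level-bound 2≤n*1024 ∷ [])))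
    where
    2≤n*1024 : 2 ≤ n * 1024
    2≤n*1024 = *-mono-≤ (≤-trans (s≤s z≤n) (toℕ<n u)) (m≤m+n 2 1022)

  UpdateRun-levels : ∀ {G G′ : Graph n} {S S′ c} → UpdateRun G S G′ S′ c → LevelsBounded S → LevelsBounded S′
  UpdateRun-levels (ins _ _ _ _ r)                     bs = StabRun-levels r bs
  UpdateRun-levels (del-nothing _ _ _ _ _)             bs = bs
  UpdateRun-levels (del-act u _ _ pre post p _ _ r) bs = StabRun-levels r (deletion-levels u p pre post bs)

  UpdateRun-Ψ : ∀ {G G′ : Graph n} {S S′ c} → UpdateRun G S G′ S′ c → LevelsBounded S →
                c + Ψ S′ ≤ Ψ S + (L * 1024 + 6)
  UpdateRun-Ψ (ins _ _ _ _ r)         bs = ≤-trans (StabRun-Ψ r bs) (m≤m+n _ _)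
  UpdateRun-Ψ (del-nothing _ _ _ _ _) bs = m≤m+n _ _
  UpdateRun-Ψ (del-act {S' = S′} {c = c} u _ _ pre post p _ _ r) bs = begin
    ΔD old mid + c + Ψ S′   ≡⟨ +-assoc (ΔD old mid) c (Ψ S′) ⟩
    ΔD old mid + (c + Ψ S′) ≤⟨ +-monoʳ-≤ (ΔD old mid) (StabRun-Ψ r (deletion-levels u p pre post bs)) ⟩
    ΔD old mid + Ψ mid      ≤⟨ Ψ-step old mid (L * 1024 + 6) (deletion-Φ u p pre post) (deletion-Dominants u p pre post) ⟩
    Ψ old + (L * 1024 + 6)  ∎
    where
    open ≤-Reasoning
    old mid : Solution n
    old = pre ++ p ∷ post
    mid = pre ++ dropVertex u p ++ post ++ dpair u ⁅ u ⁆ 1 ∷ []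

  Run-Ψ : ∀ {G : Graph n} {S k c} → Run G S k c → LevelsBounded S → c ≤ Ψ S + k * (L * 1024 + 6)
  Run-Ψ run-nil _ = z≤n
  Run-Ψ {S = S} {suc k} (run-cons {S' = S′} {c = c} {c' = c′} up r) bs = begin
    c + c′                  ≤⟨ +-monoʳ-≤ c (Run-Ψ r (UpdateRun-levels up bs)) ⟩
    c + (Ψ S′ + k * K)      ≡⟨ sym (+-assoc c (Ψ S′) (k * K)) ⟩
    c + Ψ S′ + k * K        ≤⟨ +-monoˡ-≤ (k * K) (UpdateRun-Ψ up bs) ⟩
    Ψ S + K + k * K         ≡⟨ +-assoc (Ψ S) K (k * K) ⟩
    Ψ S + suc k * K         ∎
    where
    open ≤-Reasoning
    K : ℕ
    K = L * 1024 + 6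

  weight≤*∣dom∣ : ∀ p → 2 ^ level p ≤ ∣ dom p ∣ * 1024 → weight p ≤ (L * 1024 + 2048) * ∣ dom p ∣
  weight≤*∣dom∣ p 2^l≤ = begin
    c * (L ∸ level p) * 1024 + 2 * 2 ^ level p
      ≤⟨ +-mono-≤ (*-monoˡ-≤ 1024 (*-monoʳ-≤ c (m∸n≤m L (level p)))) (*-monoʳ-≤ 2 2^l≤) ⟩
    c * L * 1024 + 2 * (c * 1024) ≡⟨ regroup c L ⟩
    (L * 1024 + 2048) * c         ∎
    where
    open ≤-Reasoning
    c : ℕ
    c = ∣ dom p ∣
    regroup : ∀ c L → c * L * 1024 + 2 * (c * 1024) ≡ (L * 1024 + 2048) * c
    regroup = solve-∀

  Φ≤*∑∣dom∣ : ∀ S → All (λ p → 2 ^ level p ≤ ∣ dom p ∣ * 1024) S →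
        Φ S ≤ (L * 1024 + 2048) * sum (map (∣_∣ ∘ dom) S)
  Φ≤*∑∣dom∣ []      []       = z≤n
  Φ≤*∑∣dom∣ (p ∷ S) (h ∷ hs) = ≤-trans (+-mono-≤ (weight≤*∣dom∣ p h) (Φ≤*∑∣dom∣ S hs))
                                 (≤-reflexive (sym (*-distribˡ-+ (L * 1024 + 2048) ∣ dom p ∣ _)))

  Ψ-initial : ∀ {G : Graph n} {S} → ValidSolution G S → ValidLevels S → Ψ S ≤ (L * 1024 + 2049) * n
  Ψ-initial {S = S} (_ , occ≡1) valid-levels = begin
    Φ S + ∣ Dominants S ∣
      ≤⟨ +-mono-≤ (Φ≤*∑∣dom∣ S (tabulate (proj₁ ∘ valid-levels _))) (∣p∣≤n (Dominants S)) ⟩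
    (L * 1024 + 2048) * sum (map (∣_∣ ∘ dom) S) + n
      ≡⟨ cong (λ m → (L * 1024 + 2048) * m + n) (occ≡1⇒∑∣dom∣≡n S occ≡1) ⟩
    (L * 1024 + 2048) * n + n ≡⟨ regroup L n ⟩
    (L * 1024 + 2049) * n     ∎
    where
    open ≤-Reasoning
    regroup : ∀ L n → (L * 1024 + 2048) * n + n ≡ (L * 1024 + 2049) * n
    regroup = solve-∀

  ValidLevels⇒LevelsBounded : ∀ {S} → ValidLevels S → LevelsBounded S
  ValidLevels⇒LevelsBounded valid-levels = tabulate (λ {p} p∈S → InR⇒≤L (dom p) (proj₁ (valid-levels p p∈S)))

⌊log₂[2^k*n]⌋≡k+⌊log₂n⌋ : ∀ k n .{{_ : NonZero n}} → ⌊log₂ (2 ^ k * n) ⌋ ≡ k + ⌊log₂ n ⌋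
⌊log₂[2^k*n]⌋≡k+⌊log₂n⌋ zero    n = cong ⌊log₂_⌋ (+-identityʳ n)
⌊log₂[2^k*n]⌋≡k+⌊log₂n⌋ (suc k) n = begin
  ⌊log₂ (2 * 2 ^ k * n) ⌋   ≡⟨ cong ⌊log₂_⌋ (*-assoc 2 (2 ^ k) n) ⟩
  ⌊log₂ (2 * (2 ^ k * n)) ⌋ ≡⟨ ⌊log₂[2*b]⌋≡1+⌊log₂b⌋ (2 ^ k * n) {{m*n≢0 (2 ^ k) n {{m^n≢0 2 k}}}} ⟩
  suc ⌊log₂ (2 ^ k * n) ⌋   ≡⟨ cong suc (⌊log₂[2^k*n]⌋≡k+⌊log₂n⌋ k n) ⟩
  suc k + ⌊log₂ n ⌋         ∎
  where open ≡-Reasoning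

2^j≤n⇒j≤⌊log₂n⌋ : ∀ {j n} → 2 ^ j ≤ n → j ≤ ⌊log₂ n ⌋
2^j≤n⇒j≤⌊log₂n⌋ {j} 2^j≤n = subst (_≤ _) (⌊log₂[2^n]⌋≡n j) (⌊log₂⌋-mono-≤ 2^j≤n)

coefficient-≤ : ∀ g → 1 ≤ g → (10 + g) * 1024 + 2049 ≤ g * 13313
coefficient-≤ g 1≤g = begin
  (10 + g) * 1024 + 2049  ≡⟨ cong (_+ 2049) (*-distribʳ-+ 1024 10 g) ⟩
  10240 + g * 1024 + 2049 ≡⟨ cong (_+ 2049) (+-comm 10240 (g * 1024)) ⟩
  g * 1024 + 10240 + 2049 ≡⟨ +-assoc (g * 1024) 10240 2049 ⟩
  g * 1024 + 12289        ≤⟨ +-monoʳ-≤ (g * 1024) (*-monoˡ-≤ 12289 1≤g) ⟩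
  g * 1024 + g * 12289    ≡⟨ sym (*-distribˡ-+ g 1024 12289) ⟩
  g * 13313               ∎
  where open ≤-Reasoning

Dominants-changes-≥2 : ∀ {n} {G : Graph n} {S k c} → 2 ≤ n → ValidSolution G S → ValidLevels S → Run G S k c →
                       c ≤ 13313 * (k * ⌊log₂ n ⌋ + n * ⌊log₂ n ⌋)
Dominants-changes-≥2 {n} {S = S} {k} {c} 2≤n valid levels run = begin
  c                                          ≤⟨ Run-Ψ run (ValidLevels⇒LevelsBounded levels) ⟩
  Ψ S + k * (L * 1024 + 6)                   ≤⟨ +-monoˡ-≤ _ (Ψ-initial valid levels) ⟩
  (L * 1024 + 2049) * n + k * (L * 1024 + 6) ≡⟨ +-comm ((L * 1024 + 2049) * n) _ ⟩
  k * (L * 1024 + 6) + (L * 1024 + 2049) * n ≡⟨ cong (k * (L * 1024 + 6) +_) (*-comm (L * 1024 + 2049) n) ⟩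
  k * (L * 1024 + 6) + n * (L * 1024 + 2049) ≤⟨ +-mono-≤ (*-monoʳ-≤ k per-update≤) (*-monoʳ-≤ n initial≤) ⟩
  k * (g * 13313) + n * (g * 13313)          ≡⟨ sym (cong₂ _+_ (*-assoc k g 13313) (*-assoc n g 13313)) ⟩
  k * g * 13313 + n * g * 13313              ≡⟨ sym (*-distribʳ-+ 13313 (k * g) (n * g)) ⟩
  (k * g + n * g) * 13313                    ≡⟨ *-comm (k * g + n * g) 13313 ⟩
  13313 * (k * g + n * g)                    ∎
  where
  open ≤-Reasoning
  L g : ℕ
  L = ⌊log₂ (n * 1024) ⌋
  g = ⌊log₂ n ⌋
  open Potential {n} L 2^j≤n⇒j≤⌊log₂n⌋
  instance
    n≢0 : NonZero n
    n≢0 = >-nonZero (≤-trans (s≤s z≤n) 2≤n)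
  L≡10+g : L ≡ 10 + g
  L≡10+g = trans (cong ⌊log₂_⌋ (*-comm n 1024)) (⌊log₂[2^k*n]⌋≡k+⌊log₂n⌋ 10 n)
  initial≤ : L * 1024 + 2049 ≤ g * 13313
  initial≤ = subst (λ m → m * 1024 + 2049 ≤ g * 13313) (sym L≡10+g)
                   (coefficient-≤ g (2^j≤n⇒j≤⌊log₂n⌋ 2≤n))
  per-update≤ : L * 1024 + 6 ≤ g * 13313
  per-update≤ = ≤-trans (+-monoʳ-≤ (L * 1024) (m≤m+n 6 2043)) initial≤

no-loop-edge : ∀ {n} {G : Graph n} {u v} → SimpleGraph G → u ≡ v → G u v ≢ true
no-loop-edge {u = u} (_ , loopless) refl Guu≡true with trans (sym Guu≡true) (loopless u)
... | ()

no-update : ∀ {n} {G G′ : Graph n} {S S′ c} → (∀ (u v : Fin n) → u ≡ v) → SimpleGraph G →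
            ¬ UpdateRun G S G′ S′ c
no-update same simple (ins u v u≢v _ _)             = u≢v (same u v)
no-update same simple (del-nothing u v Guv _ _)     = no-loop-edge simple (same u v) Guv
no-update same simple (del-act u v Guv _ _ _ _ _ _) = no-loop-edge simple (same u v) Guv

Run-trivial : ∀ {n} {G : Graph n} {S k c} → (∀ (u v : Fin n) → u ≡ v) → SimpleGraph G → Run G S k c → c ≡ 0
Run-trivial same simple run-nil             = refl
Run-trivial same simple (run-cons update _) = ⊥-elim (no-update same simple update)

Dominants-changes : ∀ n {G : Graph n} {S k c} → SimpleGraph G → ValidSolution G S → ValidLevels S →
                    Run G S k c → c ≤ 13313 * (k * ⌊log₂ n ⌋ + n * ⌊log₂ n ⌋)
Dominants-changes zero          simple _     _      run =
  ≤-trans (≤-reflexive (Run-trivial (λ ()) simple run)) z≤n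
Dominants-changes (suc zero)    simple _     _      run =
  ≤-trans (≤-reflexive (Run-trivial (λ { zero zero → refl }) simple run)) z≤n
Dominants-changes (suc (suc _)) _      valid levels run = Dominants-changes-≥2 (s≤s (s≤s z≤n)) valid levels run

corollary6 : ∃ λ (C : ℕ) → ∀ (n : ℕ) (G : Graph n) (S : Solution n) →
    SimpleGraph G → ValidSolution G S → ValidLevels S → Stable G S →
    ∀ (k c : ℕ) → Run G S k c →
    c ≤ C * (k * ⌊log₂ n ⌋ + n * ⌊log₂ n ⌋)
corollary6 = 13313 , λ n G S simple valid levels _ k c run → Dominants-changes n simple valid levels run
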